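{- Let $a,b \ge 1$ and $n \ge m$ be integers. Let $G$ be an $n$-vertex graph which is $bK_a$-free and such that every $m$-vertex induced subgraph of $G$ contains a copy of $K_a$. Then $G$ has at most $n^{b-\varepsilon}/b!$ independent sets of size $b$, where $$\varepsilon:=\left(\frac{\log \frac nm}{8ab \log n}\right)^{b}.$$
   Context: $bK_a$ denotes the disjoint union of $b$ copies of the complete graph $K_a$; a graph is $H$-free if it does not contain $H$ as an induced subgraph. All logarithms are in base 2. -}

module Defs where

open import Data.Nat using (ℕ; zero; suc; _*_; _^_; _≤_; _<_; _≟_; _!)
open import Data.Bool using (Bool; true; false)
import Data.Bool as B
open import Data.Fin using (Fin)
open import Data.Fin.Properties using (all?)
open import Data.Fin.Subset using (Subset; _∈_; ∣_∣)
open import Data.Fin.Subset.Properties using (_∈?_)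
open import Data.Vec using ([]; _∷_)
open import Data.List using (List; []; _∷_; _++_; map; filter; length)
open import Data.Product using (_×_; Σ; ∃; _,_)
open import Function.Definitions using (Injective)
open import Relation.Binary.PropositionalEquality using (_≡_; _≢_)
open import Relation.Nullary using (Dec; ¬_)
open import Relation.Nullary.Decidable using (_→-dec_; _×-dec_)

record Graph (n : ℕ) : Set where
  field
    adj    : Fin n → Fin n → Bool
    sym    : ∀ i j → adj i j ≡ adj j i
    irrefl : ∀ i → adj i i ≡ false
open Graph public

-- G contains an induced copy of K_a inside the vertex set S
-- (an induced copy of a complete graph is just a clique).
HasCliqueIn : ∀ {n} → Graph n → ℕ → Subset n → Set
HasCliqueIn {n} G a S =
  Σ (Fin a → Fin n) λ f →
    Injective _≡_ _≡_ f × (∀ x → f x ∈ S) ×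
    (∀ x y → x ≢ y → adj G (f x) (f y) ≡ true)

-- G contains bK_a (disjoint union of b copies of K_a) as an induced
-- subgraph: an injective map from (copy index, position) to vertices such
-- that two distinct image vertices are adjacent iff they lie in the same copy.
ContainsInducedBKa : ∀ {n} → Graph n → ℕ → ℕ → Set
ContainsInducedBKa {n} G b a =
  Σ (Fin b → Fin a → Fin n) λ f →
    (∀ i x j y → f i x ≡ f j y → (i ≡ j × x ≡ y)) ×
    (∀ i x j y → ¬ (i ≡ j × x ≡ y) →
       ((adj G (f i x) (f j y) ≡ true → i ≡ j) ×
        (i ≡ j → adj G (f i x) (f j y) ≡ true)))

BKaFree : ∀ {n} → Graph n → ℕ → ℕ → Set
BKaFree G b a = ¬ ContainsInducedBKa G b a

EveryMSetHasKa : ∀ {n} → Graph n → ℕ → ℕ → Set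
EveryMSetHasKa {n} G m a = ∀ (S : Subset n) → ∣ S ∣ ≡ m → HasCliqueIn G a S

Independent : ∀ {n} → Graph n → Subset n → Set
Independent G S = ∀ i j → i ∈ S → j ∈ S → adj G i j ≡ false

independent? : ∀ {n} (G : Graph n) (S : Subset n) → Dec (Independent G S)
independent? G S =
  all? λ i → all? λ j → (i ∈? S) →-dec ((j ∈? S) →-dec (adj G i j B.≟ false))

allSubsets : ∀ n → List (Subset n)
allSubsets zero    = [] ∷ []
allSubsets (suc n) = map (true ∷_) (allSubsets n) ++ map (false ∷_) (allSubsets n)

numIndepSets : ∀ {n} → Graph n → ℕ → ℕ
numIndepSets G b =
  length (filter (λ S → (∣ S ∣ ≟ b) ×-dec independent? G S) (allSubsets _))

-- The real inequality  N ≤ n^(b - ε) / b!  with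
--   ε = ( log(n/m) / (8ab log n) )^b ,
-- expressed exactly in natural-number arithmetic.  Put C = (8ab)^b,
-- u = log_n(n/m), v = log_n(n^b / (b! N)).  For n ≥ 2 and N > 0 the
-- inequality is  u^b ≤ C v,  which (as u ≥ 0) holds iff  v ≥ 0  and
-- (p/q)^b ≤ C v for every rational p/q < u.  Here  p/q < u  iff
-- m^q n^p < n^q,  and  (p/q)^b ≤ C v  iff  (b! N)^(q^b C) n^(p^b) ≤ n^(b q^b C).
-- (For N = 0 both sides hold trivially; for n = 1, where ε = 0 since
-- log(n/m) = 0, only the first clause is active: b! N ≤ 1.)
IndepBound : (n m a b N : ℕ) → Set
IndepBound n m a b N =
  ((b !) * N ≤ n ^ b) ×
  (∀ (p q : ℕ) → 1 ≤ q → (m ^ q) * (n ^ p) < n ^ q →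
     ((b !) * N) ^ (q ^ b * C) * n ^ (p ^ b) ≤ n ^ (b * (q ^ b * C)))
  where
  C : ℕ
  C = (8 * a * b) ^ b

{-# OPTIONS --safe #-}
module Submission where

-- Let N_j(R) be the number of independent j-sets inside R ⊆ V(G). By induction on j,
-- every R containing no induced jK_a satisfies
--   (j! N_j(R))^(H_j) · n ≤ m · n^(j H_j),   H_1 = 1,  H_(j+1) = 2 t H_j,
-- where t - 1 = T is chosen with m^T n^(a+1) ≤ n^T. In the step from j - 1 to j, with
-- s = t H_(j-1), the power-mean inequality bounds (j N_j)^s by n^(s-1) Σ_v deg(v)^s, and
-- deg(v)^s counts s-tuples of (j-1)-sets that v extends. For each tuple, the set X of common extenders satisfies
-- |X| ≤ m + #(a-cliques in X), because every m-set contains a K_a and deleting one of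
-- its vertices destroys a clique. A clique with common extensions lies in R, and the
-- vertices of R outside it and non-adjacent to all of it contain no (j-1)K_a, so the
-- induction hypothesis bounds the clique terms. The inequality obtained is off by a
-- factor 1 + 1/n², which squaring absorbs because m < n. Finally, for p/q < log_n(n/m),
-- taking T ≈ (a+1)q/p turns the bound for j = b into N ≤ n^(b-ε)/b!.

open import Data.Bool using (true; false; if_then_else_)
import Data.Bool as Bool
open import Data.Fin using (Fin; zero; suc)
import Data.Fin.Properties as Fin
open import Data.Fin.Subset using (Subset; inside; outside; _∈_; _∉_; _⊆_; ∣_∣; ⊥; ⊤)
open import Data.Fin.Subset.Properties using (_∈?_; _⊆?_; ⊆-min; ⊆⊤; ∉⊥; ∣⊥∣≡0; s⊆s; out⊆)
open import Data.List using (List; []; _∷_; _++_; map; length; allFin; filter)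
import Data.List as List
open import Data.List.Membership.Propositional.Properties using (∈-allFin)
open import Data.List.Properties using (map-tabulate; length-tabulate)
open import Data.List.Relation.Unary.Any using (Any; here; there)
open import Data.Nat using (ℕ; zero; suc; _+_; _*_; _^_; _≤_; _<_; z≤n; s≤s; _≟_; _!; _<?_; _≤?_; NonZero; >-nonZero)
open import Data.Nat.DivMod using (_/_; _%_; m≡m%n+[m/n]*n; m%n<n; m/n*n≤m)
open import Data.Nat.Properties
open import Algebra.Properties.CommutativeSemigroup +-commutativeSemigroup
  using () renaming (interchange to +-interchange)
open import Algebra.Properties.CommutativeSemigroup *-commutativeSemigroup
  using () renaming ( interchange to *-interchange; x∙yz≈y∙xz to x*[y*z]≡y*[x*z]
                    ; xy∙z≈xz∙y to x*y*z≡x*z*y; xy∙z≈y∙xz to x*y*z≡y*[x*z])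
open import Data.Nat.Solver using (module +-*-Solver)
open +-*-Solver using (solve; _:=_; _:+_; _:*_; _:^_; con)
open import Data.Product using (Σ; ∃; _×_; _,_; proj₁; proj₂)
open import Data.Sum using (inj₁; inj₂)
open import Data.Vec using (Vec; []; _∷_; head; tabulate; lookup; _[_]≔_; here; there)
open import Data.Vec.Properties using (lookup∘tabulate; []≔-updates)
open import Data.Vec.Relation.Unary.All as All using (All; []; _∷_)
open import Data.Vec.Relation.Unary.All.Properties using (lookup⁺; lookup⁻; All-swap)
open import Level using (Level)
open import Relation.Binary.PropositionalEquality
open import Relation.Nullary using (Dec; yes; no; does; ¬_)
open import Relation.Nullary.Decidable using (_×-dec_; _→-dec_; ¬?)
open import Relation.Nullary.Negation using (contradiction)

open import Defs hiding (sym)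

private
  variable
    ℓ ℓ′ : Level
    A B : Set
    P : Set ℓ
    Q : Set ℓ′

∑ : List A → (A → ℕ) → ℕ
∑ []       f = 0
∑ (x ∷ xs) f = f x + ∑ xs f

infixl 10 ∑
syntax ∑ xs (λ x → e) = ∑[ x ∈ xs ] e

∑-cong : (xs : List A) {f g : A → ℕ} → (∀ x → f x ≡ g x) → ∑ xs f ≡ ∑ xs g
∑-cong []       f≗g = refl
∑-cong (x ∷ xs) f≗g = cong₂ _+_ (f≗g x) (∑-cong xs f≗g)

∑-mono-≤ : (xs : List A) {f g : A → ℕ} → (∀ x → f x ≤ g x) → ∑ xs f ≤ ∑ xs g
∑-mono-≤ []       f≤g = z≤n
∑-mono-≤ (x ∷ xs) f≤g = +-mono-≤ (f≤g x) (∑-mono-≤ xs f≤g)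

∑-mono-< : (xs : List A) {f g : A → ℕ} {y : A} → Any (y ≡_) xs → f y < g y →
           (∀ x → f x ≤ g x) → ∑ xs f < ∑ xs g
∑-mono-< (x ∷ xs) (here refl) fy<gy f≤g = +-mono-<-≤ fy<gy (∑-mono-≤ xs f≤g)
∑-mono-< (x ∷ xs) (there y∈xs) fy<gy f≤g = +-mono-≤-< (f≤g x) (∑-mono-< xs y∈xs fy<gy f≤g)

∑-distrib-+ : (xs : List A) (f g : A → ℕ) → ∑[ x ∈ xs ] (f x + g x) ≡ ∑ xs f + ∑ xs g
∑-distrib-+ []       f g = refl
∑-distrib-+ (x ∷ xs) f g =
  trans (cong (f x + g x +_) (∑-distrib-+ xs f g)) (+-interchange (f x) (g x) (∑ xs f) (∑ xs g))

*-distribˡ-∑ : (xs : List A) (c : ℕ) (f : A → ℕ) → c * ∑ xs f ≡ ∑[ x ∈ xs ] (c * f x)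
*-distribˡ-∑ []       c f = *-zeroʳ c
*-distribˡ-∑ (x ∷ xs) c f = trans (*-distribˡ-+ c (f x) _) (cong (c * f x +_) (*-distribˡ-∑ xs c f))

*-distribʳ-∑ : (xs : List A) (c : ℕ) (f : A → ℕ) → ∑ xs f * c ≡ ∑[ x ∈ xs ] (f x * c)
*-distribʳ-∑ xs c f = begin
  ∑ xs f * c           ≡⟨ *-comm (∑ xs f) c ⟩
  c * ∑ xs f           ≡⟨ *-distribˡ-∑ xs c f ⟩
  ∑[ x ∈ xs ] (c * f x)  ≡⟨ ∑-cong xs (λ x → *-comm c (f x)) ⟩
  ∑[ x ∈ xs ] (f x * c)  ∎
  where open ≡-Reasoning

∑-const : (xs : List A) (c : ℕ) → ∑[ _ ∈ xs ] c ≡ length xs * c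
∑-const []       c = refl
∑-const (x ∷ xs) c = cong (c +_) (∑-const xs c)

∑-zero : (xs : List A) → ∑[ _ ∈ xs ] 0 ≡ 0
∑-zero xs = trans (∑-const xs 0) (*-zeroʳ (length xs))

∑-≤-const : (xs : List A) {f : A → ℕ} (c : ℕ) → (∀ x → f x ≤ c) → ∑ xs f ≤ length xs * c
∑-≤-const xs c f≤c = ≤-trans (∑-mono-≤ xs f≤c) (≤-reflexive (∑-const xs c))

∑-++ : (xs ys : List A) (f : A → ℕ) → ∑ (xs ++ ys) f ≡ ∑ xs f + ∑ ys f
∑-++ []       ys f = refl
∑-++ (x ∷ xs) ys f = trans (cong (f x +_) (∑-++ xs ys f)) (sym (+-assoc (f x) _ _))

∑-map : (xs : List A) (g : A → B) (f : B → ℕ) → ∑ (map g xs) f ≡ ∑[ x ∈ xs ] f (g x)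
∑-map []       g f = refl
∑-map (x ∷ xs) g f = cong (f (g x) +_) (∑-map xs g f)

∑-comm : (xs : List A) (ys : List B) (h : A → B → ℕ) →
         ∑[ x ∈ xs ] ∑[ y ∈ ys ] h x y ≡ ∑[ y ∈ ys ] ∑[ x ∈ xs ] h x y
∑-comm []       ys h = sym (∑-zero ys)
∑-comm (x ∷ xs) ys h = begin
  ∑ ys (h x) + ∑[ x ∈ xs ] ∑[ y ∈ ys ] h x y  ≡⟨ cong (∑ ys (h x) +_) (∑-comm xs ys h) ⟩
  ∑ ys (h x) + ∑[ y ∈ ys ] ∑[ x ∈ xs ] h x y  ≡⟨ ∑-distrib-+ ys (h x) _ ⟨
  ∑[ y ∈ ys ] (h x y + ∑[ x ∈ xs ] h x y) ∎
  where open ≡-Reasoning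

∑-positive : (xs : List A) (f : A → ℕ) → 0 < ∑ xs f → ∃ λ x → 0 < f x
∑-positive (x ∷ xs) f ∑>0 with f x in fx≡
... | zero  = ∑-positive xs f ∑>0
... | suc _ = x , subst (0 <_) (sym fx≡) (s≤s z≤n)

∑-product : (xs : List A) (ys : List B) (f : A → ℕ) (g : B → ℕ) →
            ∑ xs f * ∑ ys g ≡ ∑[ x ∈ xs ] ∑[ y ∈ ys ] (f x * g y)
∑-product xs ys f g = trans (*-distribʳ-∑ xs (∑ ys g) f) (∑-cong xs (λ x → *-distribˡ-∑ ys (f x) g))

∑∑-distrib-+ : (xs : List A) (ys : List B) (h k : A → B → ℕ) →
               ∑[ x ∈ xs ] ∑[ y ∈ ys ] (h x y + k x y) ≡
               ∑[ x ∈ xs ] ∑[ y ∈ ys ] h x y + ∑[ x ∈ xs ] ∑[ y ∈ ys ] k x y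
∑∑-distrib-+ xs ys h k = trans (∑-cong xs (λ x → ∑-distrib-+ ys (h x) (k x))) (∑-distrib-+ xs _ _)

𝟙 : Dec P → ℕ
𝟙 d = if does d then 1 else 0

𝟙-yes : (d : Dec P) → P → 𝟙 d ≡ 1
𝟙-yes (yes _) _  = refl
𝟙-yes (no ¬p) pr = contradiction pr ¬p

𝟙-no : (d : Dec P) → ¬ P → 𝟙 d ≡ 0
𝟙-no (yes pr) ¬p = contradiction pr ¬p
𝟙-no (no _)   _  = refl

𝟙-positive : (d : Dec P) → 0 < 𝟙 d → P
𝟙-positive (yes pr) _ = pr

𝟙-mono : (d : Dec P) (e : Dec Q) → (P → Q) → 𝟙 d ≤ 𝟙 e
𝟙-mono (yes pr) e P→Q = ≤-reflexive (sym (𝟙-yes e (P→Q pr)))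
𝟙-mono (no _)   e P→Q = z≤n

𝟙-cong : (d : Dec P) (e : Dec Q) → (P → Q) → (Q → P) → 𝟙 d ≡ 𝟙 e
𝟙-cong (yes pr) e P→Q Q→P = sym (𝟙-yes e (P→Q pr))
𝟙-cong (no ¬p) (yes qr) P→Q Q→P = contradiction (Q→P qr) ¬p
𝟙-cong (no _)  (no _)  P→Q Q→P = refl

𝟙-*-≤ : (d : Dec P) {x y : ℕ} → (P → x ≤ y) → 𝟙 d * x ≤ y
𝟙-*-≤ (yes pr) {x} x≤y = ≤-trans (≤-reflexive (+-identityʳ x)) (x≤y pr)
𝟙-*-≤ (no _)       _   = z≤n

𝟙-×-dec : (d : Dec P) (e : Dec Q) → 𝟙 (d ×-dec e) ≡ 𝟙 d * 𝟙 e
𝟙-×-dec d e with does d | does e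
... | false | _     = refl
... | true  | false = refl
... | true  | true  = refl

length-filter : {P : A → Set ℓ} (P? : ∀ x → Dec (P x)) (xs : List A) →
                length (filter P? xs) ≡ ∑[ x ∈ xs ] 𝟙 (P? x)
length-filter P? []       = refl
length-filter P? (x ∷ xs) with does (P? x)
... | true  = cong suc (length-filter P? xs)
... | false = length-filter P? xs

∑ⁿ : (s : ℕ) → List A → (Vec A s → ℕ) → ℕ
∑ⁿ zero    xs h = h []
∑ⁿ (suc s) xs h = ∑[ x ∈ xs ] ∑ⁿ s xs (λ T → h (x ∷ T))

∑ⁿ-cong : (s : ℕ) (xs : List A) {f g : Vec A s → ℕ} → (∀ T → f T ≡ g T) → ∑ⁿ s xs f ≡ ∑ⁿ s xs g
∑ⁿ-cong zero    xs f≗g = f≗g []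
∑ⁿ-cong (suc s) xs f≗g = ∑-cong xs (λ x → ∑ⁿ-cong s xs (λ T → f≗g (x ∷ T)))

∑ⁿ-mono-≤ : (s : ℕ) (xs : List A) {f g : Vec A s → ℕ} → (∀ T → f T ≤ g T) → ∑ⁿ s xs f ≤ ∑ⁿ s xs g
∑ⁿ-mono-≤ zero    xs f≤g = f≤g []
∑ⁿ-mono-≤ (suc s) xs f≤g = ∑-mono-≤ xs (λ x → ∑ⁿ-mono-≤ s xs (λ T → f≤g (x ∷ T)))

∑ⁿ-mono-< : (s : ℕ) (xs : List A) {f g : Vec A s → ℕ} {T : Vec A s} →
            All (λ x → Any (x ≡_) xs) T → f T < g T → (∀ T → f T ≤ g T) → ∑ⁿ s xs f < ∑ⁿ s xs g
∑ⁿ-mono-< zero    xs []           fT<gT f≤g = fT<gT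
∑ⁿ-mono-< (suc s) xs (x∈xs ∷ T⊆xs) fT<gT f≤g =
  ∑-mono-< xs x∈xs (∑ⁿ-mono-< s xs T⊆xs fT<gT (λ T → f≤g (_ ∷ T)))
                   (λ x → ∑ⁿ-mono-≤ s xs (λ T → f≤g (x ∷ T)))

∑ⁿ-distrib-+ : (s : ℕ) (xs : List A) (f g : Vec A s → ℕ) →
               ∑ⁿ s xs (λ T → f T + g T) ≡ ∑ⁿ s xs f + ∑ⁿ s xs g
∑ⁿ-distrib-+ zero    xs f g = refl
∑ⁿ-distrib-+ (suc s) xs f g = trans (∑-cong xs (λ x → ∑ⁿ-distrib-+ s xs _ _)) (∑-distrib-+ xs _ _)

*-distribˡ-∑ⁿ : (s : ℕ) (xs : List A) (c : ℕ) (f : Vec A s → ℕ) →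
                c * ∑ⁿ s xs f ≡ ∑ⁿ s xs (λ T → c * f T)
*-distribˡ-∑ⁿ zero    xs c f = refl
*-distribˡ-∑ⁿ (suc s) xs c f = trans (*-distribˡ-∑ xs c _) (∑-cong xs (λ x → *-distribˡ-∑ⁿ s xs c _))

∑ⁿ-≤-const : (s : ℕ) (xs : List A) {f : Vec A s → ℕ} (c : ℕ) → (∀ T → f T ≤ c) →
             ∑ⁿ s xs f ≤ length xs ^ s * c
∑ⁿ-≤-const zero    xs c f≤c = ≤-trans (f≤c []) (≤-reflexive (sym (+-identityʳ c)))
∑ⁿ-≤-const (suc s) xs {f} c f≤c = begin
  ∑ⁿ (suc s) xs f                 ≤⟨ ∑-≤-const xs _ (λ x → ∑ⁿ-≤-const s xs c (λ T → f≤c (x ∷ T))) ⟩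
  length xs * (length xs ^ s * c) ≡⟨ *-assoc (length xs) _ c ⟨
  length xs ^ suc s * c ∎
  where open ≤-Reasoning

∑ⁿ-∑-comm : (s : ℕ) (xs : List A) (ys : List B) (h : Vec A s → B → ℕ) →
            ∑ⁿ s xs (λ T → ∑[ y ∈ ys ] h T y) ≡ ∑[ y ∈ ys ] ∑ⁿ s xs (λ T → h T y)
∑ⁿ-∑-comm zero    xs ys h = refl
∑ⁿ-∑-comm (suc s) xs ys h =
  trans (∑-cong xs (λ x → ∑ⁿ-∑-comm s xs ys (λ T → h (x ∷ T)))) (∑-comm xs ys _)

∑ⁿ-comm : (s r : ℕ) (xs : List A) (ys : List B) (h : Vec A s → Vec B r → ℕ) →
          ∑ⁿ s xs (λ T → ∑ⁿ r ys (h T)) ≡ ∑ⁿ r ys (λ U → ∑ⁿ s xs (λ T → h T U))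
∑ⁿ-comm s zero    xs ys h = refl
∑ⁿ-comm s (suc r) xs ys h =
  trans (∑ⁿ-∑-comm s xs ys _) (∑-cong ys (λ y → ∑ⁿ-comm s r xs ys (λ T U → h T (y ∷ U))))

∑ⁿ-all : (s : ℕ) (xs : List A) {P : A → Set ℓ} (P? : ∀ x → Dec (P x)) →
         ∑ⁿ s xs (λ T → 𝟙 (All.all? P? T)) ≡ (∑[ x ∈ xs ] 𝟙 (P? x)) ^ s
∑ⁿ-all zero    xs P? = refl
∑ⁿ-all (suc s) xs P? = begin
  ∑[ x ∈ xs ] ∑ⁿ s xs (λ T → 𝟙 (P? x ×-dec All.all? P? T))
    ≡⟨ ∑-cong xs (λ x → ∑ⁿ-cong s xs (λ T → 𝟙-×-dec (P? x) (All.all? P? T))) ⟩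
  ∑[ x ∈ xs ] ∑ⁿ s xs (λ T → 𝟙 (P? x) * 𝟙 (All.all? P? T))
    ≡⟨ ∑-cong xs (λ x → *-distribˡ-∑ⁿ s xs (𝟙 (P? x)) _) ⟨
  ∑[ x ∈ xs ] (𝟙 (P? x) * ∑ⁿ s xs (λ T → 𝟙 (All.all? P? T)))
    ≡⟨ ∑-cong xs (λ x → cong (𝟙 (P? x) *_) (∑ⁿ-all s xs P?)) ⟩
  ∑[ x ∈ xs ] (𝟙 (P? x) * S ^ s)
    ≡⟨ *-distribʳ-∑ xs (S ^ s) _ ⟨
  S * S ^ s ∎
  where
  open ≡-Reasoning
  S = ∑[ x ∈ xs ] 𝟙 (P? x)

rearrangement : ∀ {a b c d} → a ≤ b → c ≤ d → a * d + b * c ≤ a * c + b * d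
rearrangement {a} {c = c} a≤b c≤d with m≤n⇒∃[o]m+o≡n a≤b | m≤n⇒∃[o]m+o≡n c≤d
... | x , refl | y , refl = ≤-trans (m≤m+n _ (x * y)) (≤-reflexive (solve 4
      (λ a c x y → a :* (c :+ y) :+ (a :+ x) :* c :+ x :* y := a :* c :+ (a :+ x) :* (c :+ y))
      refl a c x y))

SimilarlyOrdered : (A → ℕ) → (A → ℕ) → Set
SimilarlyOrdered f g = ∀ x y → f x * g y + f y * g x ≤ f x * g x + f y * g y

similarlyOrdered-^ : (f : A → ℕ) (k : ℕ) → SimilarlyOrdered f (λ x → f x ^ k)
similarlyOrdered-^ f k x y with ≤-total (f x) (f y)
... | inj₁ fx≤fy = rearrangement fx≤fy (^-monoˡ-≤ k fx≤fy)
... | inj₂ fy≤fx = subst₂ _≤_ (+-comm (f y * f x ^ k) _) (+-comm (f y * f y ^ k) _)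
                           (rearrangement fy≤fx (^-monoˡ-≤ k fy≤fx))

chebyshev : (xs : List A) (f g : A → ℕ) → SimilarlyOrdered f g →
            ∑ xs f * ∑ xs g ≤ length xs * ∑[ x ∈ xs ] (f x * g x)
chebyshev xs f g similar = *-cancelˡ-≤ 2 (begin
  2 * (∑ xs f * ∑ xs g)                                  ≡⟨ double-product ⟩
  ∑[ x ∈ xs ] ∑[ y ∈ xs ] (f x * g y + f y * g x)        ≤⟨ ∑-mono-≤ xs (λ x → ∑-mono-≤ xs (similar x)) ⟩
  ∑[ x ∈ xs ] ∑[ y ∈ xs ] (f x * g x + f y * g y)        ≡⟨ double-diagonal ⟩
  2 * (length xs * ∑[ x ∈ xs ] (f x * g x)) ∎)
  where
  open ≤-Reasoning
  double-product : 2 * (∑ xs f * ∑ xs g) ≡ ∑[ x ∈ xs ] ∑[ y ∈ xs ] (f x * g y + f y * g x)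
  double-product = begin-equality
    2 * (∑ xs f * ∑ xs g)
      ≡⟨ solve 2 (λ a b → con 2 :* (a :* b) := a :* b :+ b :* a) refl (∑ xs f) (∑ xs g) ⟩
    ∑ xs f * ∑ xs g + ∑ xs g * ∑ xs f
      ≡⟨ cong₂ _+_ (∑-product xs xs f g) (∑-product xs xs g f) ⟩
    ∑[ x ∈ xs ] ∑[ y ∈ xs ] (f x * g y) + ∑[ x ∈ xs ] ∑[ y ∈ xs ] (g x * f y)
      ≡⟨ cong (∑[ x ∈ xs ] ∑[ y ∈ xs ] (f x * g y) +_)
              (∑-cong xs (λ x → ∑-cong xs (λ y → *-comm (g x) (f y)))) ⟩
    ∑[ x ∈ xs ] ∑[ y ∈ xs ] (f x * g y) + ∑[ x ∈ xs ] ∑[ y ∈ xs ] (f y * g x)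
      ≡⟨ ∑∑-distrib-+ xs xs _ _ ⟨
    ∑[ x ∈ xs ] ∑[ y ∈ xs ] (f x * g y + f y * g x) ∎
  double-diagonal : ∑[ x ∈ xs ] ∑[ y ∈ xs ] (f x * g x + f y * g y) ≡
                    2 * (length xs * ∑[ x ∈ xs ] (f x * g x))
  double-diagonal = begin-equality
    ∑[ x ∈ xs ] ∑[ y ∈ xs ] (f x * g x + f y * g y)
      ≡⟨ ∑∑-distrib-+ xs xs _ _ ⟩
    ∑[ x ∈ xs ] ∑[ _ ∈ xs ] (f x * g x) + ∑[ _ ∈ xs ] ∑[ y ∈ xs ] (f y * g y)
      ≡⟨ cong₂ _+_ (∑-cong xs (λ x → ∑-const xs (f x * g x))) (∑-const xs _) ⟩
    ∑[ x ∈ xs ] (length xs * (f x * g x)) + length xs * ∑[ x ∈ xs ] (f x * g x)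
      ≡⟨ cong (_+ length xs * ∑[ x ∈ xs ] (f x * g x)) (*-distribˡ-∑ xs (length xs) _) ⟨
    length xs * ∑[ x ∈ xs ] (f x * g x) + length xs * ∑[ x ∈ xs ] (f x * g x)
      ≡⟨ solve 1 (λ a → a :+ a := con 2 :* a) refl (length xs * ∑[ x ∈ xs ] (f x * g x)) ⟩
    2 * (length xs * ∑[ x ∈ xs ] (f x * g x)) ∎

power-mean : (xs : List A) (f : A → ℕ) (s : ℕ) →
             ∑ xs f ^ suc s ≤ length xs ^ s * ∑[ x ∈ xs ] (f x ^ suc s)
power-mean xs f zero = ≤-reflexive (trans (*-identityʳ (∑ xs f))
  (sym (trans (+-identityʳ _) (∑-cong xs (λ x → *-identityʳ (f x))))))
power-mean xs f (suc s) = begin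
  ∑ xs f * ∑ xs f ^ suc s
    ≤⟨ *-monoʳ-≤ (∑ xs f) (power-mean xs f s) ⟩
  ∑ xs f * (n ^ s * ∑[ x ∈ xs ] (f x ^ suc s))
    ≡⟨ x*[y*z]≡y*[x*z] (∑ xs f) (n ^ s) _ ⟩
  n ^ s * (∑ xs f * ∑[ x ∈ xs ] (f x ^ suc s))
    ≤⟨ *-monoʳ-≤ (n ^ s) (chebyshev xs f _ (similarlyOrdered-^ f (suc s))) ⟩
  n ^ s * (n * ∑[ x ∈ xs ] (f x * f x ^ suc s))
    ≡⟨ *-assoc (n ^ s) n _ ⟨
  n ^ s * n * ∑[ x ∈ xs ] (f x ^ suc (suc s))
    ≡⟨ cong (_* ∑[ x ∈ xs ] (f x ^ suc (suc s))) (*-comm (n ^ s) n) ⟩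
  n ^ suc s * ∑[ x ∈ xs ] (f x ^ suc (suc s)) ∎
  where
  open ≤-Reasoning
  n = length xs

length-allFin : ∀ n → length (allFin n) ≡ n
length-allFin n = length-tabulate (λ v → v)

∑-allFin-suc : ∀ {n} (f : Fin (suc n) → ℕ) → ∑ (allFin (suc n)) f ≡ f zero + ∑[ v ∈ allFin n ] f (suc v)
∑-allFin-suc {n} f = cong (f zero +_) (begin
  ∑ (List.tabulate suc) f     ≡⟨ cong (λ vs → ∑ vs f) (map-tabulate (λ v → v) suc) ⟨
  ∑ (map suc (allFin n)) f    ≡⟨ ∑-map (allFin n) suc f ⟩
  ∑[ v ∈ allFin n ] f (suc v) ∎)
  where open ≡-Reasoning

∑-allSubsets-suc : ∀ {n} (f : Subset (suc n) → ℕ) →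
  ∑ (allSubsets (suc n)) f ≡ ∑[ S ∈ allSubsets n ] f (inside ∷ S) + ∑[ S ∈ allSubsets n ] f (outside ∷ S)
∑-allSubsets-suc {n} f = trans (∑-++ (map (inside ∷_) (allSubsets n)) _ f)
  (cong₂ _+_ (∑-map (allSubsets n) (inside ∷_) f) (∑-map (allSubsets n) (outside ∷_) f))

x∉p[x]≔outside : ∀ {n} (x : Fin n) p → x ∉ p [ x ]≔ outside
x∉p[x]≔outside (suc x) (_ ∷ p) (there x∈p) = x∉p[x]≔outside x p x∈p

p⊆p[x]≔inside : ∀ {n} (x : Fin n) p → p ⊆ p [ x ]≔ inside
p⊆p[x]≔inside zero    (_ ∷ p) here       = here
p⊆p[x]≔inside zero    (_ ∷ p) (there y∈) = there y∈
p⊆p[x]≔inside (suc x) (_ ∷ p) here       = here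
p⊆p[x]≔inside (suc x) (_ ∷ p) (there y∈) = there (p⊆p[x]≔inside x p y∈)

p[x]≔outside⊆p : ∀ {n} (x : Fin n) p → p [ x ]≔ outside ⊆ p
p[x]≔outside⊆p zero    (_ ∷ p) (there y∈) = there y∈
p[x]≔outside⊆p (suc x) (_ ∷ p) here       = here
p[x]≔outside⊆p (suc x) (_ ∷ p) (there y∈) = there (p[x]≔outside⊆p x p y∈)

∣p[x]≔inside∣ : ∀ {n} (x : Fin n) p → x ∉ p → ∣ p [ x ]≔ inside ∣ ≡ suc ∣ p ∣
∣p[x]≔inside∣ zero    (outside ∷ p) x∉p = refl
∣p[x]≔inside∣ zero    (inside  ∷ p) x∉p = contradiction here x∉p
∣p[x]≔inside∣ (suc x) (outside ∷ p) x∉p = ∣p[x]≔inside∣ x p (λ x∈p → x∉p (there x∈p))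
∣p[x]≔inside∣ (suc x) (inside  ∷ p) x∉p = cong suc (∣p[x]≔inside∣ x p (λ x∈p → x∉p (there x∈p)))

∣p∣≡1+∣p[x]≔outside∣ : ∀ {n} (x : Fin n) p → x ∈ p → ∣ p ∣ ≡ suc ∣ p [ x ]≔ outside ∣
∣p∣≡1+∣p[x]≔outside∣ zero    (inside  ∷ p) here        = refl
∣p∣≡1+∣p[x]≔outside∣ (suc x) (outside ∷ p) (there x∈p) = ∣p∣≡1+∣p[x]≔outside∣ x p x∈p
∣p∣≡1+∣p[x]≔outside∣ (suc x) (inside  ∷ p) (there x∈p) = cong suc (∣p∣≡1+∣p[x]≔outside∣ x p x∈p)

∣p∣≡∑∈ : ∀ {n} (p : Subset n) → ∣ p ∣ ≡ ∑[ v ∈ allFin n ] 𝟙 (v ∈? p)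
∣p∣≡∑∈ []            = refl
∣p∣≡∑∈ (inside  ∷ p) = trans (cong suc (∣p∣≡∑∈ p)) (sym (∑-allFin-suc (λ v → 𝟙 (v ∈? inside ∷ p))))
∣p∣≡∑∈ (outside ∷ p) = trans (∣p∣≡∑∈ p) (sym (∑-allFin-suc (λ v → 𝟙 (v ∈? outside ∷ p))))

⊆-of-size : ∀ {n} (p : Subset n) k → k ≤ ∣ p ∣ → ∃ λ q → q ⊆ p × ∣ q ∣ ≡ k
⊆-of-size {n} p zero _ = ⊥ , ⊆-min p , ∣⊥∣≡0 n
⊆-of-size (inside  ∷ p) (suc k) (s≤s k≤∣p∣) with ⊆-of-size p k k≤∣p∣
... | q , q⊆p , ∣q∣≡k = inside ∷ q , s⊆s q⊆p , cong suc ∣q∣≡k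
⊆-of-size (outside ∷ p) (suc k) k<∣p∣ with ⊆-of-size p (suc k) k<∣p∣
... | q , q⊆p , ∣q∣≡k = outside ∷ q , out⊆ q⊆p , ∣q∣≡k

select : ∀ {n} {P : Fin n → Set ℓ} → (∀ v → Dec (P v)) → Subset n
select P? = tabulate (λ v → does (P? v))

∈-select⁺ : ∀ {n} {P : Fin n → Set ℓ} (P? : ∀ v → Dec (P v)) {v : Fin n} → P v → v ∈ select P?
∈-select⁺ P? {zero} Pv with P? zero
... | yes _  = here
... | no ¬Pv = contradiction Pv ¬Pv
∈-select⁺ P? {suc v} Pv = there (∈-select⁺ (λ w → P? (suc w)) Pv)

∈-select⁻ : ∀ {n} {P : Fin n → Set ℓ} (P? : ∀ v → Dec (P v)) {v : Fin n} → v ∈ select P? → P v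
∈-select⁻ P? {zero} v∈ with P? zero | v∈
... | yes Pv | _ = Pv
∈-select⁻ P? {suc v} (there v∈) = ∈-select⁻ (λ w → P? (suc w)) v∈

∣select∣ : ∀ {n} {P : Fin n → Set ℓ} (P? : ∀ v → Dec (P v)) → ∣ select P? ∣ ≡ ∑[ v ∈ allFin n ] 𝟙 (P? v)
∣select∣ P? = trans (∣p∣≡∑∈ (select P?))
  (∑-cong (allFin _) (λ v → 𝟙-cong (v ∈? select P?) (P? v) (∈-select⁻ P?) (∈-select⁺ P?)))

∑-insert : ∀ {n} (F : Subset n → ℕ) (v : Fin n) →
  ∑[ S ∈ allSubsets n ] (𝟙 (¬? (v ∈? S)) * F (S [ v ]≔ inside)) ≡ ∑[ T ∈ allSubsets n ] (𝟙 (v ∈? T) * F T)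
∑-insert {suc n} F zero = begin
  ∑[ S ∈ allSubsets (suc n) ] (𝟙 (¬? (zero ∈? S)) * F (S [ zero ]≔ inside))
    ≡⟨ ∑-allSubsets-suc (λ S → 𝟙 (¬? (zero ∈? S)) * F (S [ zero ]≔ inside)) ⟩
  ∑[ S ∈ allSubsets n ] 0 + ∑[ S ∈ allSubsets n ] (F (inside ∷ S) + 0)
    ≡⟨ +-comm (∑[ S ∈ allSubsets n ] 0) _ ⟩
  ∑[ S ∈ allSubsets n ] (F (inside ∷ S) + 0) + ∑[ S ∈ allSubsets n ] 0
    ≡⟨ ∑-allSubsets-suc (λ T → 𝟙 (zero ∈? T) * F T) ⟨
  ∑[ T ∈ allSubsets (suc n) ] (𝟙 (zero ∈? T) * F T) ∎
  where open ≡-Reasoning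
∑-insert {suc n} F (suc v) = begin
  ∑[ S ∈ allSubsets (suc n) ] (𝟙 (¬? (suc v ∈? S)) * F (S [ suc v ]≔ inside))
    ≡⟨ ∑-allSubsets-suc (λ S → 𝟙 (¬? (suc v ∈? S)) * F (S [ suc v ]≔ inside)) ⟩
  ∑[ S ∈ allSubsets n ] (𝟙 (¬? (v ∈? S)) * F (inside ∷ S [ v ]≔ inside)) +
  ∑[ S ∈ allSubsets n ] (𝟙 (¬? (v ∈? S)) * F (outside ∷ S [ v ]≔ inside))
    ≡⟨ cong₂ _+_ (∑-insert (λ S → F (inside ∷ S)) v) (∑-insert (λ S → F (outside ∷ S)) v) ⟩
  ∑[ T ∈ allSubsets n ] (𝟙 (v ∈? T) * F (inside ∷ T)) + ∑[ T ∈ allSubsets n ] (𝟙 (v ∈? T) * F (outside ∷ T))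
    ≡⟨ ∑-allSubsets-suc (λ T → 𝟙 (suc v ∈? T) * F T) ⟨
  ∑[ T ∈ allSubsets (suc n) ] (𝟙 (suc v ∈? T) * F T) ∎
  where open ≡-Reasoning

∑-size-zero : ∀ n → ∑[ T ∈ allSubsets n ] 𝟙 (∣ T ∣ ≟ 0) ≡ 1
∑-size-zero zero    = refl
∑-size-zero (suc n) =
  trans (∑-allSubsets-suc {n} (λ T → 𝟙 (∣ T ∣ ≟ 0))) (cong₂ _+_ (∑-zero (allSubsets n)) (∑-size-zero n))

^-distribʳ-* : ∀ x y k → (x * y) ^ k ≡ x ^ k * y ^ k
^-distribʳ-* x y zero    = refl
^-distribʳ-* x y (suc k) = trans (cong (x * y *_) (^-distribʳ-* x y k)) (*-interchange x y (x ^ k) (y ^ k))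

*-^-mono : ∀ {x y z} k → x * y ≤ z → x ^ k * y ^ k ≤ z ^ k
*-^-mono {x} {y} k xy≤z = ≤-trans (≤-reflexive (sym (^-distribʳ-* x y k))) (^-monoˡ-≤ k xy≤z)

^-cancelˡ-≤ : ∀ {x y} k → x ^ suc k ≤ y ^ suc k → x ≤ y
^-cancelˡ-≤ {x} {y} k x^k≤y^k with x ≤? y
... | yes x≤y = x≤y
... | no  x≰y = contradiction x^k≤y^k (<⇒≱ (^-monoˡ-< (suc k) (≰⇒> x≰y)))

x^k*x^k≡x^[2*k] : ∀ x k → x ^ k * x ^ k ≡ x ^ (2 * k)
x^k*x^k≡x^[2*k] x k = trans (sym (^-distribˡ-+-* x k k)) (cong (x ^_) (cong (k +_) (sym (+-identityʳ k))))

raise-bound : ∀ {x n m e} H t → x ^ H * n ≤ m * n ^ e → x ^ (H * t) * n ^ t ≤ m ^ t * n ^ (e * t)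
raise-bound {x} {n} {m} {e} H t xᴴn≤mnᵉ = begin
  x ^ (H * t) * n ^ t     ≡⟨ cong (_* n ^ t) (^-*-assoc x H t) ⟨
  (x ^ H) ^ t * n ^ t     ≡⟨ ^-distribʳ-* (x ^ H) n t ⟨
  (x ^ H * n) ^ t         ≤⟨ ^-monoˡ-≤ t xᴴn≤mnᵉ ⟩
  (m * n ^ e) ^ t         ≡⟨ ^-distribʳ-* m (n ^ e) t ⟩
  m ^ t * (n ^ e) ^ t     ≡⟨ cong (m ^ t *_) (^-*-assoc n e t) ⟩
  m ^ t * n ^ (e * t) ∎
  where open ≤-Reasoning

pad-exponent : ∀ {X n b E₀ E Y} → X ≤ n ^ b → E₀ ≤ E → X ^ E₀ * Y ≤ n ^ (b * E₀) → X ^ E * Y ≤ n ^ (b * E)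
pad-exponent {X} {n} {b} {E₀} {E} {Y} X≤nᵇ E₀≤E bound with m≤n⇒∃[o]m+o≡n E₀≤E
... | d , refl = begin
  X ^ (E₀ + d) * Y
    ≡⟨ cong (_* Y) (trans (^-distribˡ-+-* X E₀ d) (*-comm (X ^ E₀) (X ^ d))) ⟩
  X ^ d * X ^ E₀ * Y
    ≡⟨ *-assoc (X ^ d) (X ^ E₀) Y ⟩
  X ^ d * (X ^ E₀ * Y)
    ≤⟨ *-mono-≤ (^-monoˡ-≤ d X≤nᵇ) bound ⟩
  (n ^ b) ^ d * n ^ (b * E₀)
    ≡⟨ cong (_* n ^ (b * E₀)) (^-*-assoc n b d) ⟩
  n ^ (b * d) * n ^ (b * E₀)
    ≡⟨ ^-distribˡ-+-* n (b * d) (b * E₀) ⟨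
  n ^ (b * d + b * E₀)
    ≡⟨ cong (n ^_) (trans (+-comm (b * d) (b * E₀)) (sym (*-distribˡ-+ b E₀ d))) ⟩
  n ^ (b * (E₀ + d)) ∎
  where open ≤-Reasoning

ceiling-multiple : ∀ A p .{{_ : NonZero p}} → ∃ λ T → A ≤ p * T × p * T ≤ A + p
ceiling-multiple A p = suc (A / p) , A≤pT , pT≤A+p
  where
  open ≤-Reasoning
  pT≡ : p * suc (A / p) ≡ p + A / p * p
  pT≡ = trans (*-suc p (A / p)) (cong (p +_) (*-comm p (A / p)))
  A≤pT : A ≤ p * suc (A / p)
  A≤pT = begin
    A                  ≡⟨ m≡m%n+[m/n]*n A p ⟩
    A % p + A / p * p  ≤⟨ +-monoˡ-≤ (A / p * p) (<⇒≤ (m%n<n A p)) ⟩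
    p + A / p * p      ≡⟨ pT≡ ⟨
    p * suc (A / p) ∎
  pT≤A+p : p * suc (A / p) ≤ A + p
  pT≤A+p = begin
    p * suc (A / p)    ≡⟨ pT≡ ⟩
    p + A / p * p      ≤⟨ +-monoʳ-≤ p (m/n*n≤m A p) ⟩
    p + A              ≡⟨ +-comm p A ⟩
    A + p ∎

level-combine : ∀ {n m F J P D M Q E} →
  J ≤ P * D → D ≤ m * M + Q → F * M ≤ E → F * Q * (n * n) ≤ m * E →
  F * J * (n * n) ≤ P * (m * E) * (n * n + 1)
level-combine {n} {m} {F} {J} {P} {D} {M} {Q} {E} J≤PD D≤mM+Q FM≤E FQn²≤mE = begin
  F * J * (n * n)
    ≤⟨ *-monoˡ-≤ (n * n) (*-monoʳ-≤ F (≤-trans J≤PD (*-monoʳ-≤ P D≤mM+Q))) ⟩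
  F * (P * (m * M + Q)) * (n * n)
    ≡⟨ solve 6 (λ F P m M Q n → F :* (P :* (m :* M :+ Q)) :* (n :* n)
                               := P :* (m :* (F :* M) :* (n :* n) :+ F :* Q :* (n :* n))) refl F P m M Q n ⟩
  P * (m * (F * M) * (n * n) + F * Q * (n * n))
    ≤⟨ *-monoʳ-≤ P (+-mono-≤ (*-monoˡ-≤ (n * n) (*-monoʳ-≤ m FM≤E)) FQn²≤mE) ⟩
  P * (m * E * (n * n) + m * E)
    ≡⟨ solve 4 (λ P m E n → P :* (m :* E :* (n :* n) :+ m :* E) := P :* (m :* E) :* (n :* n :+ con 1)) refl P m E n ⟩
  P * (m * E) * (n * n + 1) ∎
  where open ≤-Reasoning

-- The hypothesis says Y ≤ m W (1 + 1/n²) / n. Squaring turns the error factor into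
-- m (n² + 1)² / n⁵, which is at most 1 because m < n.
square-absorbs : ∀ {n m Y W} → m < n →
  Y * (n * n * n) ≤ m * W * (n * n + 1) → Y * Y * n ≤ m * (W * W)
square-absorbs {n@(suc n₀)} {m} {Y} {W} m<n Yn³≤mW[n²+1] = *-cancelʳ-≤ _ _ (n ^ 5) (begin
  Y * Y * n * n ^ 5
    ≡⟨ solve 2 (λ Y n → Y :* Y :* n :* (n :^ 5) := Y :* (n :* n :* n) :* (Y :* (n :* n :* n))) refl Y n ⟩
  (Y * (n * n * n)) * (Y * (n * n * n))
    ≤⟨ *-mono-≤ Yn³≤mW[n²+1] Yn³≤mW[n²+1] ⟩
  (m * W * (n * n + 1)) * (m * W * (n * n + 1))
    ≡⟨ solve 3 (λ m W n → m :* W :* (n :* n :+ con 1) :* (m :* W :* (n :* n :+ con 1))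
                         := m :* (W :* W) :* (m :* ((n :* n :+ con 1) :* (n :* n :+ con 1)))) refl m W n ⟩
  m * (W * W) * (m * ((n * n + 1) * (n * n + 1)))
    ≤⟨ *-monoʳ-≤ (m * (W * W)) (m[n²+1]²≤n⁵ m<n) ⟩
  m * (W * W) * n ^ 5 ∎)
  where
  open ≤-Reasoning
  m[n²+1]²≤n⁵ : ∀ {m n} → m < n → m * ((n * n + 1) * (n * n + 1)) ≤ n ^ 5
  m[n²+1]²≤n⁵ {m} {suc k} (s≤s m≤k) = begin
    m * ((suc k * suc k + 1) * (suc k * suc k + 1))
      ≤⟨ *-monoˡ-≤ _ m≤k ⟩
    k * ((suc k * suc k + 1) * (suc k * suc k + 1))
      ≤⟨ m≤m+n _ _ ⟩
    k * ((suc k * suc k + 1) * (suc k * suc k + 1)) + (k ^ 4 + 2 * k ^ 3 + 2 * k ^ 2 + k + 1)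
      ≡⟨ solve 1 (λ k → k :* (((con 1 :+ k) :* (con 1 :+ k) :+ con 1) :* ((con 1 :+ k) :* (con 1 :+ k) :+ con 1))
                          :+ (k :^ 4 :+ con 2 :* k :^ 3 :+ con 2 :* k :^ 2 :+ k :+ con 1)
                        := (con 1 :+ k) :^ 5) refl k ⟩
    suc k ^ 5 ∎

absorb-clique-term : ∀ {n m a T F Q E} → 0 < n → m ^ T * n ^ suc a ≤ n ^ T →
  F * n ^ suc T * Q ≤ n ^ a * (m ^ suc T * E) → F * Q * (n * n) ≤ m * E
absorb-clique-term {n} {m} {a} {T} {F} {Q} {E} n>0 mᵀnᵃ⁺¹≤nᵀ bound =
  *-cancelʳ-≤ _ _ (n ^ T) {{m^n≢0 n T {{>-nonZero n>0}}}} (begin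
    F * Q * (n * n) * n ^ T
      ≡⟨ solve 4 (λ F Q n nᵀ → F :* Q :* (n :* n) :* nᵀ := n :* (F :* (n :* nᵀ) :* Q)) refl F Q n (n ^ T) ⟩
    n * (F * n ^ suc T * Q)
      ≤⟨ *-monoʳ-≤ n bound ⟩
    n * (n ^ a * (m ^ suc T * E))
      ≡⟨ solve 5 (λ n nᵃ m mᵀ E → n :* (nᵃ :* (m :* mᵀ :* E)) := m :* E :* (mᵀ :* (n :* nᵃ)))
                 refl n (n ^ a) m (m ^ T) E ⟩
    m * E * (m ^ T * n ^ suc a)
      ≤⟨ *-monoʳ-≤ (m * E) mᵀnᵃ⁺¹≤nᵀ ⟩
    m * E * n ^ T ∎)
  where open ≤-Reasoning

-- levelExponent t k is the exponent H_(k+1) of the induction.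
levelExponent : ℕ → ℕ → ℕ
levelExponent t zero    = 1
levelExponent t (suc k) = 2 * (levelExponent t k * t)

levelExponent-positive : ∀ t k → 1 ≤ t → 1 ≤ levelExponent t k
levelExponent-positive t zero    _   = ≤-refl
levelExponent-positive t (suc k) t≥1 = ≤-trans (*-mono-≤ (levelExponent-positive t k t≥1) t≥1) (m≤n*m _ 2)

levelExponent-bound : ∀ {t p q c} k → t * p ≤ c * q → levelExponent t k * p ^ k ≤ (2 * c) ^ k * q ^ k
levelExponent-bound zero tp≤cq = ≤-refl
levelExponent-bound {t} {p} {q} {c} (suc k) tp≤cq = begin
  2 * (levelExponent t k * t) * (p * p ^ k)
    ≡⟨ solve 4 (λ H t p pᵏ → con 2 :* (H :* t) :* (p :* pᵏ) := con 2 :* (t :* p) :* (H :* pᵏ))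
               refl (levelExponent t k) t p (p ^ k) ⟩
  2 * (t * p) * (levelExponent t k * p ^ k)
    ≤⟨ *-mono-≤ (*-monoʳ-≤ 2 tp≤cq) (levelExponent-bound {t} {p} {q} {c} k tp≤cq) ⟩
  2 * (c * q) * ((2 * c) ^ k * q ^ k)
    ≡⟨ solve 4 (λ c q x y → con 2 :* (c :* q) :* (x :* y) := con 2 :* c :* x :* (q :* y))
               refl c q ((2 * c) ^ k) (q ^ k) ⟩
  2 * c * (2 * c) ^ k * (q * q ^ k) ∎
  where open ≤-Reasoning

module IndependentSets {n : ℕ} (G : Graph n) where

  IndependentIn : ℕ → Subset n → Subset n → Set
  IndependentIn j R T = ∣ T ∣ ≡ j × T ⊆ R × Independent G T

  independentIn? : ∀ j R T → Dec (IndependentIn j R T)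
  independentIn? j R T = (∣ T ∣ ≟ j) ×-dec (T ⊆? R) ×-dec independent? G T

  #indep : ℕ → Subset n → ℕ
  #indep j R = ∑[ T ∈ allSubsets n ] 𝟙 (independentIn? j R T)

  numIndepSets≡#indep : ∀ b → numIndepSets G b ≡ #indep b ⊤
  numIndepSets≡#indep b =
    trans (length-filter (λ S → (∣ S ∣ ≟ b) ×-dec independent? G S) (allSubsets n))
    (∑-cong (allSubsets n) λ S → 𝟙-cong ((∣ S ∣ ≟ b) ×-dec independent? G S) (independentIn? b ⊤ S)
      (λ (∣S∣≡b , S-independent) → ∣S∣≡b , ⊆⊤ , S-independent)
      (λ (∣S∣≡b , _ , S-independent) → ∣S∣≡b , S-independent))

  Extends : ℕ → Subset n → Fin n → Subset n → Set
  Extends j R v S = v ∉ S × IndependentIn j R (S [ v ]≔ inside)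

  extends? : ∀ j R v S → Dec (Extends j R v S)
  extends? j R v S = ¬? (v ∈? S) ×-dec independentIn? j R (S [ v ]≔ inside)

  degree : ℕ → Subset n → Fin n → ℕ
  degree j R v = ∑[ S ∈ allSubsets n ] 𝟙 (extends? j R v S)

  handshake : ∀ j R → ∑[ v ∈ allFin n ] degree j R v ≡ j * #indep j R
  handshake j R = begin
    ∑[ v ∈ allFin n ] ∑[ S ∈ allSubsets n ] 𝟙 (extends? j R v S)
      ≡⟨ ∑-cong (allFin n) (λ v → ∑-cong (allSubsets n) (λ S →
           𝟙-×-dec (¬? (v ∈? S)) (independentIn? j R (S [ v ]≔ inside)))) ⟩
    ∑[ v ∈ allFin n ] ∑[ S ∈ allSubsets n ] (𝟙 (¬? (v ∈? S)) * F (S [ v ]≔ inside))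
      ≡⟨ ∑-cong (allFin n) (∑-insert F) ⟩
    ∑[ v ∈ allFin n ] ∑[ T ∈ allSubsets n ] (𝟙 (v ∈? T) * F T)
      ≡⟨ ∑-comm (allFin n) (allSubsets n) _ ⟩
    ∑[ T ∈ allSubsets n ] ∑[ v ∈ allFin n ] (𝟙 (v ∈? T) * F T)
      ≡⟨ ∑-cong (allSubsets n) (λ T →
           trans (cong (_* F T) (∣p∣≡∑∈ T)) (*-distribʳ-∑ (allFin n) (F T) _)) ⟨
    ∑[ T ∈ allSubsets n ] (∣ T ∣ * F T)
      ≡⟨ ∑-cong (allSubsets n) (λ T → size-of-independent T (independentIn? j R T)) ⟩
    ∑[ T ∈ allSubsets n ] (j * F T)
      ≡⟨ *-distribˡ-∑ (allSubsets n) j F ⟨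
    j * #indep j R ∎
    where
    open ≡-Reasoning
    F : Subset n → ℕ
    F T = 𝟙 (independentIn? j R T)
    size-of-independent : ∀ T (d : Dec (IndependentIn j R T)) → ∣ T ∣ * 𝟙 d ≡ j * 𝟙 d
    size-of-independent T (yes (∣T∣≡j , _)) = cong (_* 1) ∣T∣≡j
    size-of-independent T (no _)            = trans (*-zeroʳ ∣ T ∣) (sym (*-zeroʳ j))

  extends⇒independentIn : ∀ {k R v S} → Extends (suc k) R v S → IndependentIn k R S
  extends⇒independentIn {v = v} {S} (v∉S , ∣S+v∣≡1+k , S+v⊆R , S+v-independent) =
    suc-injective (trans (sym (∣p[x]≔inside∣ v S v∉S)) ∣S+v∣≡1+k) ,
    (λ w∈S → S+v⊆R (S⊆S+v w∈S)) ,
    (λ i j i∈S j∈S → S+v-independent i j (S⊆S+v i∈S) (S⊆S+v j∈S))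
    where
    S⊆S+v = p⊆p[x]≔inside v S

  degree≤#indep : ∀ k R v → degree (suc k) R v ≤ #indep k R
  degree≤#indep k R v = ∑-mono-≤ (allSubsets n) (λ S →
    𝟙-mono (extends? (suc k) R v S) (independentIn? k R S) extends⇒independentIn)

  #indep-zero : ∀ R → #indep 0 R ≤ 1
  #indep-zero R = ≤-trans (∑-mono-≤ (allSubsets n) (λ T → 𝟙-mono (independentIn? 0 R T) (∣ T ∣ ≟ 0) proj₁))
                          (≤-reflexive (∑-size-zero n))

  factorial-bound : ∀ j R → j ! * #indep j R ≤ n ^ j
  factorial-bound zero    R = ≤-trans (≤-reflexive (+-identityʳ _)) (#indep-zero R)
  factorial-bound (suc k) R = begin
    suc k ! * #indep (suc k) R
      ≡⟨ *-assoc (suc k) (k !) _ ⟩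
    suc k * (k ! * #indep (suc k) R)
      ≡⟨ x*[y*z]≡y*[x*z] (suc k) (k !) _ ⟩
    k ! * (suc k * #indep (suc k) R)
      ≡⟨ cong (k ! *_) (handshake (suc k) R) ⟨
    k ! * ∑[ v ∈ allFin n ] degree (suc k) R v
      ≤⟨ *-monoʳ-≤ (k !) (∑-≤-const (allFin n) _ (degree≤#indep k R)) ⟩
    k ! * (length (allFin n) * #indep k R)
      ≡⟨ cong (λ ℓ → k ! * (ℓ * #indep k R)) (length-allFin n) ⟩
    k ! * (n * #indep k R)
      ≡⟨ x*[y*z]≡y*[x*z] (k !) n _ ⟩
    n * (k ! * #indep k R)
      ≤⟨ *-monoʳ-≤ n (factorial-bound k R) ⟩
    n * n ^ k ∎
    where open ≤-Reasoning

  factorial-bound-^ : ∀ j R s → (j !) ^ s * #indep j R ^ s ≤ n ^ (j * s)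
  factorial-bound-^ j R s = begin
    (j !) ^ s * #indep j R ^ s   ≡⟨ ^-distribʳ-* (j !) (#indep j R) s ⟨
    (j ! * #indep j R) ^ s       ≤⟨ ^-monoˡ-≤ s (factorial-bound j R) ⟩
    (n ^ j) ^ s                  ≡⟨ ^-*-assoc n j s ⟩
    n ^ (j * s)                  ∎
    where open ≤-Reasoning

  power-mean-degrees : ∀ j R s →
    (j * #indep j R) ^ suc s ≤ n ^ s * ∑[ v ∈ allFin n ] (degree j R v ^ suc s)
  power-mean-degrees j R s = subst₂ (λ d ℓ → d ^ suc s ≤ ℓ ^ s * ∑[ v ∈ allFin n ] (degree j R v ^ suc s))
    (handshake j R) (length-allFin n) (power-mean (allFin n) (degree j R) s)

module Cliques {n : ℕ} (G : Graph n) (a₀ : ℕ) where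

  open IndependentSets G

  a : ℕ
  a = suc a₀

  IsClique : Vec (Fin n) a → Set
  IsClique V = ∀ x y → x ≢ y → adj G (lookup V x) (lookup V y) ≡ true

  isClique? : ∀ V → Dec (IsClique V)
  isClique? V = Fin.all? λ x → Fin.all? λ y →
    ¬? (x Fin.≟ y) →-dec (adj G (lookup V x) (lookup V y) Bool.≟ true)

  CliqueIn : Subset n → Vec (Fin n) a → Set
  CliqueIn χ V = IsClique V × All (_∈ χ) V

  cliqueIn? : ∀ χ V → Dec (CliqueIn χ V)
  cliqueIn? χ V = isClique? V ×-dec All.all? (_∈? χ) V

  cliqueCount : Subset n → ℕ
  cliqueCount χ = ∑ⁿ a (allFin n) (λ V → 𝟙 (cliqueIn? χ V))

  clique-injective : ∀ V → IsClique V → ∀ x y → lookup V x ≡ lookup V y → x ≡ y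
  clique-injective V V-clique x y Vx≡Vy with x Fin.≟ y
  ... | yes x≡y = x≡y
  ... | no  x≢y = contradiction (trans (sym (irrefl G (lookup V x))) Vx~Vx) λ ()
    where
    Vx~Vx : adj G (lookup V x) (lookup V x) ≡ true
    Vx~Vx = subst (λ u → adj G (lookup V x) u ≡ true) (sym Vx≡Vy) (V-clique x y x≢y)

  clique-in : ∀ {χ} → HasCliqueIn G a χ → ∃ (CliqueIn χ)
  clique-in {χ} (f , _ , f∈χ , f-adjacent) = tabulate f , clique , lookup⁻ in-χ
    where
    clique : IsClique (tabulate f)
    clique x y x≢y = subst₂ (λ u w → adj G u w ≡ true) (sym (lookup∘tabulate f x)) (sym (lookup∘tabulate f y))
                            (f-adjacent x y x≢y)
    in-χ : ∀ x → lookup (tabulate f) x ∈ χ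
    in-χ x = subst (_∈ χ) (sym (lookup∘tabulate f x)) (f∈χ x)

  EveryMSetHasKa⇒m>0 : ∀ {m} → EveryMSetHasKa G m a → 0 < m
  EveryMSetHasKa⇒m>0 {zero}  every with every ⊥ (∣⊥∣≡0 n)
  ... | f , _ , f∈⊥ , _ = contradiction (f∈⊥ zero) ∉⊥
  EveryMSetHasKa⇒m>0 {suc _} every = s≤s z≤n

  cliqueCount-delete : ∀ χ V → CliqueIn χ V → cliqueCount (χ [ head V ]≔ outside) < cliqueCount χ
  cliqueCount-delete χ V@(v ∷ _) V-in-χ =
    ∑ⁿ-mono-< a (allFin n) (All.universal ∈-allFin V) V-counted-only-in-χ
      (λ U → 𝟙-mono (cliqueIn? χ′ U) (cliqueIn? χ U)
                    (λ (U-clique , U⊆χ′) → U-clique , All.map (p[x]≔outside⊆p v χ) U⊆χ′))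
    where
    χ′ = χ [ v ]≔ outside
    V-counted-only-in-χ : 𝟙 (cliqueIn? χ′ V) < 𝟙 (cliqueIn? χ V)
    V-counted-only-in-χ = subst₂ _<_
      (sym (𝟙-no (cliqueIn? χ′ V) (λ (_ , V⊆χ′) → x∉p[x]≔outside v χ (All.head V⊆χ′))))
      (sym (𝟙-yes (cliqueIn? χ V) V-in-χ))
      (s≤s z≤n)

  ExtendsAll : ∀ {s} → ℕ → Subset n → Fin n → Vec (Subset n) s → Set
  ExtendsAll j R v T = All (Extends j R v) T

  extendsAll? : ∀ {s} j R v (T : Vec (Subset n) s) → Dec (ExtendsAll j R v T)
  extendsAll? j R v T = All.all? (extends? j R v) T

  ExtendedByAll : ℕ → Subset n → Vec (Fin n) a → Subset n → Set
  ExtendedByAll j R V S = All (λ w → Extends j R w S) V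

  extendedByAll? : ∀ j R V S → Dec (ExtendedByAll j R V S)
  extendedByAll? j R V S = All.all? (λ w → extends? j R w S) V

  commonExtenders : ∀ {s} → ℕ → Subset n → Vec (Subset n) s → Subset n
  commonExtenders j R T = select (λ v → extendsAll? j R v T)

  commonExtensions : ℕ → Subset n → Vec (Fin n) a → ℕ
  commonExtensions j R V = ∑[ S ∈ allSubsets n ] 𝟙 (extendedByAll? j R V S)

  cliqueTerm : ℕ → Subset n → ℕ → ℕ
  cliqueTerm j R s = ∑ⁿ a (allFin n) (λ V → 𝟙 (isClique? V) * commonExtensions j R V ^ s)

  ∑degree^s≡∑∣commonExtenders∣ : ∀ j R s →
    ∑[ v ∈ allFin n ] (degree j R v ^ s) ≡ ∑ⁿ s (allSubsets n) (λ T → ∣ commonExtenders j R T ∣)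
  ∑degree^s≡∑∣commonExtenders∣ j R s = begin
    ∑[ v ∈ allFin n ] (degree j R v ^ s)
      ≡⟨ ∑-cong (allFin n) (λ v → ∑ⁿ-all s (allSubsets n) (extends? j R v)) ⟨
    ∑[ v ∈ allFin n ] ∑ⁿ s (allSubsets n) (λ T → 𝟙 (extendsAll? j R v T))
      ≡⟨ ∑ⁿ-∑-comm s (allSubsets n) (allFin n) _ ⟨
    ∑ⁿ s (allSubsets n) (λ T → ∑[ v ∈ allFin n ] 𝟙 (extendsAll? j R v T))
      ≡⟨ ∑ⁿ-cong s (allSubsets n) (λ T → ∣select∣ (λ v → extendsAll? j R v T)) ⟨
    ∑ⁿ s (allSubsets n) (λ T → ∣ commonExtenders j R T ∣) ∎
    where open ≡-Reasoning

  ∑cliqueCount-commonExtenders : ∀ j R s →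
    ∑ⁿ s (allSubsets n) (λ T → cliqueCount (commonExtenders j R T)) ≡ cliqueTerm j R s
  ∑cliqueCount-commonExtenders j R s = begin
    ∑ⁿ s (allSubsets n) (λ T → ∑ⁿ a (allFin n) (λ V → 𝟙 (cliqueIn? (commonExtenders j R T) V)))
      ≡⟨ ∑ⁿ-comm s a (allSubsets n) (allFin n) (λ T V → 𝟙 (cliqueIn? (commonExtenders j R T) V)) ⟩
    ∑ⁿ a (allFin n) (λ V → ∑ⁿ s (allSubsets n) (λ T → 𝟙 (cliqueIn? (commonExtenders j R T) V)))
      ≡⟨ ∑ⁿ-cong a (allFin n) (λ V → ∑ⁿ-cong s (allSubsets n) (λ T →
           trans (𝟙-×-dec (isClique? V) (V⊆? T V)) (cong (𝟙 (isClique? V) *_) (swap-quantifiers V T)))) ⟩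
    ∑ⁿ a (allFin n) (λ V → ∑ⁿ s (allSubsets n) (λ T → 𝟙 (isClique? V) * 𝟙 (T-extended? V T)))
      ≡⟨ ∑ⁿ-cong a (allFin n) (λ V → *-distribˡ-∑ⁿ s (allSubsets n) (𝟙 (isClique? V)) (λ T → 𝟙 (T-extended? V T))) ⟨
    ∑ⁿ a (allFin n) (λ V → 𝟙 (isClique? V) * ∑ⁿ s (allSubsets n) (λ T → 𝟙 (T-extended? V T)))
      ≡⟨ ∑ⁿ-cong a (allFin n) (λ V → cong (𝟙 (isClique? V) *_) (∑ⁿ-all s (allSubsets n) (extendedByAll? j R V))) ⟩
    cliqueTerm j R s ∎
    where
    open ≡-Reasoning
    V⊆? : (T : Vec (Subset n) s) (V : Vec (Fin n) a) → Dec (All (_∈ commonExtenders j R T) V)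
    V⊆? T V = All.all? (_∈? commonExtenders j R T) V
    T-extended? : (V : Vec (Fin n) a) (T : Vec (Subset n) s) → Dec (All (ExtendedByAll j R V) T)
    T-extended? V T = All.all? (extendedByAll? j R V) T
    swap-quantifiers : ∀ V T → 𝟙 (V⊆? T V) ≡ 𝟙 (T-extended? V T)
    swap-quantifiers V T = 𝟙-cong (V⊆? T V) (T-extended? V T)
      (λ V⊆ → All-swap (All.map (∈-select⁻ (λ v → extendsAll? j R v T)) V⊆))
      (λ T-extended → All.map (∈-select⁺ (λ v → extendsAll? j R v T)) (All-swap T-extended))

  NonNeighbour : Vec (Fin n) a → Fin n → Set
  NonNeighbour V u = All (λ w → w ≢ u × adj G w u ≡ false) V

  nonNeighbourIn? : ∀ R V u → Dec (u ∈ R × NonNeighbour V u)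
  nonNeighbourIn? R V u = u ∈? R ×-dec All.all? (λ w → ¬? (w Fin.≟ u) ×-dec (adj G w u Bool.≟ false)) V

  nonNeighbours : Subset n → Vec (Fin n) a → Subset n
  nonNeighbours R V = select (nonNeighbourIn? R V)

  extendedByAll⇒independent : ∀ {k R V S} → ExtendedByAll (suc k) R V S → IndependentIn k (nonNeighbours R V) S
  extendedByAll⇒independent {k} {R} {V} {S} V-extends@(w-extends ∷ _) with extends⇒independentIn w-extends
  ... | ∣S∣≡k , S⊆R , S-independent = ∣S∣≡k , S⊆nonNeighbours , S-independent
    where
    S⊆nonNeighbours : S ⊆ nonNeighbours R V
    S⊆nonNeighbours {u} u∈S = ∈-select⁺ (nonNeighbourIn? R V) (S⊆R u∈S , All.map non-adjacent V-extends)
      where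
      non-adjacent : ∀ {w} → Extends (suc k) R w S → w ≢ u × adj G w u ≡ false
      non-adjacent {w} (w∉S , _ , _ , S+w-independent) =
        (λ { refl → w∉S u∈S }) , S+w-independent w u ([]≔-updates S w) (p⊆p[x]≔inside w S u∈S)

  commonExtensions≤#indep : ∀ k R V → commonExtensions (suc k) R V ≤ #indep k (nonNeighbours R V)
  commonExtensions≤#indep k R V = ∑-mono-≤ (allSubsets n) λ S →
    𝟙-mono (extendedByAll? (suc k) R V S) (independentIn? k (nonNeighbours R V) S) extendedByAll⇒independent

  commonExtensions-positive : ∀ j R V → 0 < commonExtensions j R V → All (_∈ R) V
  commonExtensions-positive j R V c>0 with ∑-positive (allSubsets n) _ c>0
  ... | S , 𝟙>0 = All.map (λ {w} (_ , _ , S+w⊆R , _) → S+w⊆R ([]≔-updates S w))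
                          (𝟙-positive (extendedByAll? j R V S) 𝟙>0)

  CopiesIn : Subset n → ℕ → Set
  CopiesIn R b = Σ (ContainsInducedBKa G b a) λ copies → ∀ i x → proj₁ copies i x ∈ R

  no-copies : ∀ R → CopiesIn R 0
  no-copies R = ((λ ()) , (λ ()) , (λ ())) , (λ ())

  extend-copies : ∀ {k R V} → CliqueIn R V → CopiesIn (nonNeighbours R V) k → CopiesIn R (suc k)
  extend-copies {k} {R} {V} (V-clique , V⊆R) ((g , g-injective , g-induced) , g∈) =
    (h , h-injective , h-induced) , h∈R
    where
    h : Fin (suc k) → Fin a → Fin n
    h zero    = lookup V
    h (suc i) = g i
    g-nonNeighbour : ∀ i x → g i x ∈ R × NonNeighbour V (g i x)
    g-nonNeighbour i x = ∈-select⁻ (nonNeighbourIn? R V) (g∈ i x)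
    apart : ∀ i x y → lookup V y ≢ g i x × adj G (lookup V y) (g i x) ≡ false
    apart i x = lookup⁺ (proj₂ (g-nonNeighbour i x))
    h-injective : ∀ i x j y → h i x ≡ h j y → i ≡ j × x ≡ y
    h-injective zero    x zero    y hx≡hy = refl , clique-injective V V-clique x y hx≡hy
    h-injective zero    x (suc j) y hx≡hy = contradiction hx≡hy (proj₁ (apart j y x))
    h-injective (suc i) x zero    y hx≡hy = contradiction (sym hx≡hy) (proj₁ (apart i x y))
    h-injective (suc i) x (suc j) y hx≡hy with g-injective i x j y hx≡hy
    ... | refl , x≡y = refl , x≡y
    h-induced : ∀ i x j y → ¬ (i ≡ j × x ≡ y) →
                (adj G (h i x) (h j y) ≡ true → i ≡ j) × (i ≡ j → adj G (h i x) (h j y) ≡ true)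
    h-induced zero    x zero    y ≢ = (λ _ → refl) , (λ _ → V-clique x y (λ x≡y → ≢ (refl , x≡y)))
    h-induced zero    x (suc j) y ≢ =
      (λ adjacent → contradiction (trans (sym adjacent) (proj₂ (apart j y x))) λ ()) , λ ()
    h-induced (suc i) x zero    y ≢ =
      (λ adjacent → contradiction (trans (sym adjacent) (trans (Graph.sym G _ _) (proj₂ (apart i x y)))) λ ()) , λ ()
    h-induced (suc i) x (suc j) y ≢ with g-induced i x j y (λ (i≡j , x≡y) → ≢ (cong suc i≡j , x≡y))
    ... | same-copy , adjacent =
      (λ adj≡true → cong suc (same-copy adj≡true)) , (λ i≡j → adjacent (Fin.suc-injective i≡j))
    h∈R : ∀ i x → h i x ∈ R
    h∈R zero    x = lookup⁺ V⊆R x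
    h∈R (suc i) x = proj₁ (g-nonNeighbour i x)

  nonNeighbours-copy-free : ∀ {k R V} → ¬ CopiesIn R (suc k) → IsClique V → 0 < commonExtensions (suc k) R V →
                            ¬ CopiesIn (nonNeighbours R V) k
  nonNeighbours-copy-free {V = V} R-free V-clique c>0 copies =
    R-free (extend-copies (V-clique , commonExtensions-positive _ _ V c>0) copies)

  module _ {m : ℕ} (every : EveryMSetHasKa G m a) where

    large-set-has-clique : ∀ {χ} → m ≤ ∣ χ ∣ → ∃ (CliqueIn χ)
    large-set-has-clique {χ} m≤∣χ∣ with ⊆-of-size χ m m≤∣χ∣
    ... | S , S⊆χ , ∣S∣≡m with clique-in (every S ∣S∣≡m)
    ...   | V , V-clique , V⊆S = V , V-clique , All.map S⊆χ V⊆S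

    clique-cover : ∀ χ → ∣ χ ∣ ≤ m + cliqueCount χ
    clique-cover χ = go ∣ χ ∣ χ ≤-refl
      where
      go : ∀ k χ → ∣ χ ∣ ≤ k → ∣ χ ∣ ≤ m + cliqueCount χ
      go zero    χ ∣χ∣≤0 = ≤-trans ∣χ∣≤0 z≤n
      go (suc k) χ ∣χ∣≤1+k with m <? ∣ χ ∣
      ... | no  m≮∣χ∣ = ≤-trans (≮⇒≥ m≮∣χ∣) (m≤m+n m _)
      ... | yes m<∣χ∣ = delete-clique-vertex (large-set-has-clique (<⇒≤ m<∣χ∣))
        where
        delete-clique-vertex : ∃ (CliqueIn χ) → ∣ χ ∣ ≤ m + cliqueCount χ
        delete-clique-vertex (V@(v ∷ _) , V-in-χ@(_ , v∈χ ∷ _)) = begin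
          ∣ χ ∣
            ≡⟨ ∣χ∣≡1+∣χ′∣ ⟩
          suc ∣ χ′ ∣
            ≤⟨ s≤s (go k χ′ (≤-pred (≤-trans (≤-reflexive (sym ∣χ∣≡1+∣χ′∣)) ∣χ∣≤1+k))) ⟩
          suc (m + cliqueCount χ′)
            ≡⟨ +-suc m _ ⟨
          m + suc (cliqueCount χ′)
            ≤⟨ +-monoʳ-≤ m (cliqueCount-delete χ V V-in-χ) ⟩
          m + cliqueCount χ ∎
          where
          open ≤-Reasoning
          χ′ = χ [ v ]≔ outside
          ∣χ∣≡1+∣χ′∣ : ∣ χ ∣ ≡ suc ∣ χ′ ∣
          ∣χ∣≡1+∣χ′∣ = ∣p∣≡1+∣p[x]≔outside∣ v χ v∈χ

    ∣commonExtenders∣≤ : ∀ {s} k R (T : Vec (Subset n) s) →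
      ∣ commonExtenders (suc k) R T ∣ ≤
      m * 𝟙 (All.all? (independentIn? k R) T) + cliqueCount (commonExtenders (suc k) R T)
    ∣commonExtenders∣≤ k R T with All.all? (independentIn? k R) T
    ... | yes _ = subst (λ c → ∣ χ ∣ ≤ c + cliqueCount χ) (sym (*-identityʳ m)) (clique-cover χ)
      where χ = commonExtenders (suc k) R T
    ... | no ¬T-independent = begin
      ∣ commonExtenders (suc k) R T ∣                  ≡⟨ ∣select∣ (λ v → extendsAll? (suc k) R v T) ⟩
      ∑[ v ∈ allFin n ] 𝟙 (extendsAll? (suc k) R v T)  ≡⟨ ∑-cong (allFin n) no-extenders ⟩
      ∑[ v ∈ allFin n ] 0                              ≡⟨ ∑-zero (allFin n) ⟩
      0                                                ≤⟨ z≤n ⟩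
      _ ∎
      where
      open ≤-Reasoning
      no-extenders : ∀ v → 𝟙 (extendsAll? (suc k) R v T) ≡ 0
      no-extenders v = 𝟙-no (extendsAll? (suc k) R v T) (λ T-extended →
        ¬T-independent (All.map extends⇒independentIn T-extended))

    degree-moment : ∀ k R s →
      ∑[ v ∈ allFin n ] (degree (suc k) R v ^ s) ≤ m * #indep k R ^ s + cliqueTerm (suc k) R s
    degree-moment k R s = begin
      ∑[ v ∈ allFin n ] (degree (suc k) R v ^ s)
        ≡⟨ ∑degree^s≡∑∣commonExtenders∣ (suc k) R s ⟩
      ∑ⁿ s (allSubsets n) (λ T → ∣ commonExtenders (suc k) R T ∣)
        ≤⟨ ∑ⁿ-mono-≤ s (allSubsets n) (∣commonExtenders∣≤ k R) ⟩
      ∑ⁿ s (allSubsets n) (λ T →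
        m * 𝟙 (All.all? (independentIn? k R) T) + cliqueCount (commonExtenders (suc k) R T))
        ≡⟨ ∑ⁿ-distrib-+ s (allSubsets n) _ _ ⟩
      ∑ⁿ s (allSubsets n) (λ T → m * 𝟙 (All.all? (independentIn? k R) T)) +
      ∑ⁿ s (allSubsets n) (λ T → cliqueCount (commonExtenders (suc k) R T))
        ≡⟨ cong₂ _+_ (trans (sym (*-distribˡ-∑ⁿ s (allSubsets n) m _))
                            (cong (m *_) (∑ⁿ-all s (allSubsets n) (independentIn? k R))))
                     (∑cliqueCount-commonExtenders (suc k) R s) ⟩
      m * #indep k R ^ s + cliqueTerm (suc k) R s ∎
      where open ≤-Reasoning

    LevelBound : ℕ → ℕ → Set
    LevelBound j H = ∀ R → ¬ CopiesIn R j → (j ! * #indep j R) ^ H * n ≤ m * n ^ (j * H)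

    level-one : LevelBound 1 1
    level-one R R-free = begin
      (1 ! * #indep 1 R) ^ 1 * n
        ≡⟨ cong (_* n) (*-identityʳ (1 ! * #indep 1 R)) ⟩
      1 * #indep 1 R * n
        ≡⟨ cong (_* n) (handshake 1 R) ⟨
      ∑[ v ∈ allFin n ] degree 1 R v * n
        ≡⟨ cong (_* n) (∑-cong (allFin n) (λ v → *-identityʳ (degree 1 R v))) ⟨
      ∑[ v ∈ allFin n ] (degree 1 R v ^ 1) * n
        ≤⟨ *-monoˡ-≤ n (degree-moment 0 R 1) ⟩
      (m * #indep 0 R ^ 1 + cliqueTerm 1 R 1) * n
        ≤⟨ *-monoˡ-≤ n (+-mono-≤ (*-monoʳ-≤ m (≤-trans (≤-reflexive (*-identityʳ _)) (#indep-zero R)))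
                                 no-cliqueTerm) ⟩
      (m * 1 + 0) * n
        ≡⟨ solve 2 (λ m n → (m :* con 1 :+ con 0) :* n := m :* (n :* con 1)) refl m n ⟩
      m * n ^ 1 ∎
      where
      open ≤-Reasoning
      no-extensions : ∀ V → IsClique V → commonExtensions 1 R V ^ 1 ≤ 0
      no-extensions V V-clique with commonExtensions 1 R V in c≡
      ... | zero  = z≤n
      ... | suc _ = contradiction (no-copies _)
                      (nonNeighbours-copy-free {V = V} R-free V-clique (subst (0 <_) (sym c≡) (s≤s z≤n)))
      no-cliqueTerm : cliqueTerm 1 R 1 ≤ 0
      no-cliqueTerm = ≤-trans (∑ⁿ-≤-const a (allFin n) 0 (λ V → 𝟙-*-≤ (isClique? V) (no-extensions V)))
                              (≤-reflexive (*-zeroʳ (length (allFin n) ^ a)))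

    module _ {T : ℕ} (m<n : m < n) (mᵀnᵃ⁺¹≤nᵀ : m ^ T * n ^ suc a ≤ n ^ T) where

      cliqueTerm-bound : ∀ k H R → 1 ≤ H → LevelBound (suc k) H → ¬ CopiesIn R (suc (suc k)) →
        (suc k !) ^ (H * suc T) * cliqueTerm (suc (suc k)) R (H * suc T) * (n * n) ≤
        m * n ^ (suc k * (H * suc T))
      cliqueTerm-bound k H@(suc _) R _ IH R-free =
        absorb-clique-term {n} {m} {a} {T} {F} {cliqueTerm (suc k₁) R s} {n ^ (k₁ * s)}
                           (≤-trans (s≤s z≤n) m<n) mᵀnᵃ⁺¹≤nᵀ (begin
          F * n ^ t * cliqueTerm (suc k₁) R s
            ≡⟨ *-distribˡ-∑ⁿ a (allFin n) (F * n ^ t) (λ V → 𝟙 (isClique? V) * c V ^ s) ⟩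
          ∑ⁿ a (allFin n) (λ V → F * n ^ t * (𝟙 (isClique? V) * c V ^ s))
            ≡⟨ ∑ⁿ-cong a (allFin n) (λ V → x*[y*z]≡y*[x*z] (F * n ^ t) (𝟙 (isClique? V)) (c V ^ s)) ⟩
          ∑ⁿ a (allFin n) (λ V → 𝟙 (isClique? V) * (F * n ^ t * c V ^ s))
            ≤⟨ ∑ⁿ-≤-const a (allFin n) (m ^ t * n ^ (k₁ * s)) (λ V → 𝟙-*-≤ (isClique? V) (per-clique V)) ⟩
          length (allFin n) ^ a * (m ^ t * n ^ (k₁ * s))
            ≡⟨ cong (λ ℓ → ℓ ^ a * (m ^ t * n ^ (k₁ * s))) (length-allFin n) ⟩
          n ^ a * (m ^ t * n ^ (k₁ * s)) ∎)
        where
        open ≤-Reasoning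
        t = suc T
        s = H * t
        k₁ = suc k
        F = (k₁ !) ^ s
        c : Vec (Fin n) a → ℕ
        c = commonExtensions (suc k₁) R
        per-clique : ∀ V → IsClique V → F * n ^ t * c V ^ s ≤ m ^ t * n ^ (k₁ * s)
        per-clique V V-clique = bound (c V) refl
          where
          bound : ∀ x → x ≡ c V → F * n ^ t * x ^ s ≤ m ^ t * n ^ (k₁ * s)
          bound zero    _   = ≤-trans (≤-reflexive (*-zeroʳ (F * n ^ t))) z≤n
          bound (suc x) x≡c = begin
            F * n ^ t * suc x ^ s        ≡⟨ x*y*z≡x*z*y F (n ^ t) (suc x ^ s) ⟩
            F * suc x ^ s * n ^ t        ≡⟨ cong (_* n ^ t) (^-distribʳ-* (k₁ !) (suc x) s) ⟨
            (k₁ ! * suc x) ^ s * n ^ t   ≤⟨ raise-bound {k₁ ! * suc x} {n} {m} {k₁ * H} H t IH′ ⟩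
            m ^ t * n ^ (k₁ * H * t)     ≡⟨ cong (λ e → m ^ t * n ^ e) (*-assoc k₁ H t) ⟩
            m ^ t * n ^ (k₁ * s) ∎
            where
            x≤#indep : suc x ≤ #indep k₁ (nonNeighbours R V)
            x≤#indep = ≤-trans (≤-reflexive x≡c) (commonExtensions≤#indep k₁ R V)
            nonNeighbours-free : ¬ CopiesIn (nonNeighbours R V) k₁
            nonNeighbours-free = nonNeighbours-copy-free {V = V} R-free V-clique (subst (0 <_) x≡c (s≤s z≤n))
            IH′ : (k₁ ! * suc x) ^ H * n ≤ m * n ^ (k₁ * H)
            IH′ = ≤-trans (*-monoˡ-≤ n (^-monoˡ-≤ H (*-monoʳ-≤ (k₁ !) x≤#indep)))
                          (IH (nonNeighbours R V) nonNeighbours-free)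

      level-step : ∀ k H → 1 ≤ H → LevelBound (suc k) H → LevelBound (suc (suc k)) (2 * (H * suc T))
      level-step k H@(suc H₀) H≥1 IH R R-free =
        subst₂ (λ Y W → Y * n ≤ m * W) (x^k*x^k≡x^[2*k] (j ! * N) s)
               (trans (x^k*x^k≡x^[2*k] n (j * s)) (cong (n ^_) (x*[y*z]≡y*[x*z] 2 j s)))
          (square-absorbs {Y = (j ! * N) ^ s} {W = n ^ (j * s)} m<n (begin
            (j ! * N) ^ s * (n * n * n)
              ≡⟨ cong (λ y → y ^ s * (n * n * n)) (x*y*z≡y*[x*z] j (k₁ !) N) ⟩
            (k₁ ! * (j * N)) ^ s * (n * n * n)
              ≡⟨ cong (_* (n * n * n)) (^-distribʳ-* (k₁ !) (j * N) s) ⟩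
            F * (j * N) ^ s * (n * n * n)
              ≡⟨ solve 2 (λ Y n → Y :* (n :* n :* n) := n :* (Y :* (n :* n))) refl (F * (j * N) ^ s) n ⟩
            n * (F * (j * N) ^ s * (n * n))
              ≤⟨ *-monoʳ-≤ n combined ⟩
            n * (n ^ s₀ * (m * E) * (n * n + 1))
              ≡⟨ solve 5 (λ n P m E u → n :* (P :* (m :* E) :* u) := m :* (n :* P :* E) :* u)
                         refl n (n ^ s₀) m E (n * n + 1) ⟩
            m * (n ^ s * E) * (n * n + 1)
              ≡⟨ cong (λ W → m * W * (n * n + 1)) (^-distribˡ-+-* n s (k₁ * s)) ⟨
            m * n ^ (j * s) * (n * n + 1) ∎))
        where
        open ≤-Reasoning
        t = suc T
        s₀ = T + H₀ * t
        s = H * t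
        k₁ = suc k
        j = suc k₁
        N = #indep j R
        F = (k₁ !) ^ s
        E = n ^ (k₁ * s)
        combined : F * (j * N) ^ s * (n * n) ≤ n ^ s₀ * (m * E) * (n * n + 1)
        combined = level-combine {n} {m} {F} {(j * N) ^ s} {n ^ s₀} {∑[ v ∈ allFin n ] (degree j R v ^ s)}
                                 {#indep k₁ R ^ s} {cliqueTerm j R s} {E}
                                 (power-mean-degrees j R s₀) (degree-moment k₁ R s) (factorial-bound-^ k₁ R s)
                                 (cliqueTerm-bound k H R H≥1 IH R-free)

      levels : ∀ k → LevelBound (suc k) (levelExponent (suc T) k)
      levels zero    = level-one
      levels (suc k) = level-step k _ (levelExponent-positive (suc T) k (s≤s z≤n)) (levels k)

-- m ^ q * n ^ p < n ^ q says that p/q < log_n (n/m).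
gap⇒m<n : ∀ {m n p q} → 0 < n → m ^ q * n ^ p < n ^ q → m < n
gap⇒m<n {m} {n} {p} {q} n>0 gap with m <? n
... | yes m<n = m<n
... | no  m≮n = contradiction gap (≤⇒≯ (begin
  n ^ q          ≤⟨ ^-monoˡ-≤ q (≮⇒≥ m≮n) ⟩
  m ^ q          ≤⟨ m≤m*n (m ^ q) (n ^ p) {{m^n≢0 n p {{>-nonZero n>0}}}} ⟩
  m ^ q * n ^ p  ∎))
  where open ≤-Reasoning

gap⇒p≤q : ∀ {m n p q} → 0 < m → 0 < n → m ^ q * n ^ p < n ^ q → p ≤ q
gap⇒p≤q {m} {n} {p} {q} m>0 n>0 gap with p ≤? q
... | yes p≤q = p≤q
... | no  p≰q = contradiction gap (≤⇒≯ (begin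
  n ^ q          ≤⟨ ^-monoʳ-≤ n {{>-nonZero n>0}} (<⇒≤ (≰⇒> p≰q)) ⟩
  n ^ p          ≤⟨ m≤n*m (n ^ p) (m ^ q) {{m^n≢0 m q {{>-nonZero m>0}}}} ⟩
  m ^ q * n ^ p  ∎))
  where open ≤-Reasoning

mᵀnᴬ≤nᵀ : ∀ {m n p q T} A → 0 < q → m ^ q * n ^ p ≤ n ^ q → A * q ≤ p * T → 0 < n → m ^ T * n ^ A ≤ n ^ T
mᵀnᴬ≤nᵀ {m} {n} {p} {suc q₀} {T} A _ mᵍnᵖ≤nᵍ Aq≤pT n>0 = ^-cancelˡ-≤ q₀ (begin
  (m ^ T * n ^ A) ^ q
    ≡⟨ ^-distribʳ-* (m ^ T) (n ^ A) q ⟩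
  (m ^ T) ^ q * (n ^ A) ^ q
    ≡⟨ cong₂ _*_ (^-*-assoc m T q) (^-*-assoc n A q) ⟩
  m ^ (T * q) * n ^ (A * q)
    ≤⟨ *-monoʳ-≤ (m ^ (T * q)) (^-monoʳ-≤ n {{>-nonZero n>0}} Aq≤pT) ⟩
  m ^ (T * q) * n ^ (p * T)
    ≡⟨ cong₂ _*_ (trans (cong (m ^_) (*-comm T q)) (sym (^-*-assoc m q T))) (sym (^-*-assoc n p T)) ⟩
  (m ^ q) ^ T * (n ^ p) ^ T
    ≤⟨ *-^-mono T mᵍnᵖ≤nᵍ ⟩
  (n ^ q) ^ T
    ≡⟨ trans (^-*-assoc n q T) (trans (cong (n ^_) (*-comm q T)) (sym (^-*-assoc n T q))) ⟩
  (n ^ T) ^ q ∎)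
  where
  open ≤-Reasoning
  q = suc q₀

cancel-gap : ∀ {X n m e H p q} → 0 < n → X ^ H * n ≤ m * n ^ e → m ^ q * n ^ p ≤ n ^ q →
             X ^ (H * q) * n ^ p ≤ n ^ (e * q)
cancel-gap {X} {n} {m} {e} {H} {p} {q} n>0 Xᴴn≤mnᵉ mᵍnᵖ≤nᵍ =
  *-cancelʳ-≤ _ _ (n ^ q) {{m^n≢0 n q {{>-nonZero n>0}}}} (begin
    X ^ (H * q) * n ^ p * n ^ q  ≡⟨ x*y*z≡x*z*y (X ^ (H * q)) (n ^ p) (n ^ q) ⟩
    X ^ (H * q) * n ^ q * n ^ p  ≤⟨ *-monoˡ-≤ (n ^ p) (raise-bound {X} {n} {m} {e} H q Xᴴn≤mnᵉ) ⟩
    m ^ q * n ^ (e * q) * n ^ p  ≡⟨ x*y*z≡x*z*y (m ^ q) (n ^ (e * q)) (n ^ p) ⟩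
    m ^ q * n ^ p * n ^ (e * q)  ≤⟨ *-monoˡ-≤ (n ^ (e * q)) mᵍnᵖ≤nᵍ ⟩
    n ^ q * n ^ (e * q)          ≡⟨ *-comm (n ^ q) (n ^ (e * q)) ⟩
    n ^ (e * q) * n ^ q ∎)
  where open ≤-Reasoning

raise-exponents : ∀ {X n e₁ e₂ e₃} k → X ^ e₁ * n ^ e₂ ≤ n ^ e₃ → X ^ (e₁ * k) * n ^ (e₂ * k) ≤ n ^ (e₃ * k)
raise-exponents {X} {n} {e₁} {e₂} {e₃} k bound =
  subst₂ (λ u w → u * w ≤ n ^ (e₃ * k)) (^-*-assoc X e₁ k) (^-*-assoc n e₂ k)
    (≤-trans (*-^-mono k bound) (≤-reflexive (^-*-assoc n e₃ k)))

step-count-bound : ∀ {a p q T} → 1 ≤ a → p ≤ q → p * T ≤ suc a * q + p → suc T * p ≤ 4 * a * q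
step-count-bound {a} {p} {q} {T} a≥1 p≤q pT≤ = begin
  suc T * p                 ≡⟨ trans (*-comm (suc T) p) (*-suc p T) ⟩
  p + p * T                 ≤⟨ +-monoʳ-≤ p pT≤ ⟩
  p + (suc a * q + p)       ≤⟨ +-mono-≤ p≤q (+-monoʳ-≤ (suc a * q) p≤q) ⟩
  q + (suc a * q + q)       ≡⟨ solve 2 (λ a q → q :+ ((con 1 :+ a) :* q :+ q) := (con 3 :+ a) :* q) refl a q ⟩
  (3 + a) * q               ≤⟨ *-monoˡ-≤ q (+-monoˡ-≤ a (*-monoʳ-≤ 3 a≥1)) ⟩
  (3 * a + a) * q           ≡⟨ cong (_* q) (solve 1 (λ a → con 3 :* a :+ a := con 4 :* a) refl a) ⟩
  4 * a * q ∎
  where open ≤-Reasoning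

exponent-budget : ∀ {a b₀ p q t} → 1 ≤ a → t * p ≤ 4 * a * q →
  levelExponent t b₀ * q * p ^ b₀ ≤ q ^ suc b₀ * (8 * a * suc b₀) ^ suc b₀
exponent-budget {a} {b₀} {p} {q} {t} a≥1 tp≤4aq = begin
  H * q * p ^ b₀
    ≡⟨ solve 3 (λ H q k → H :* q :* k := q :* (H :* k)) refl H q (p ^ b₀) ⟩
  q * (H * p ^ b₀)
    ≤⟨ *-monoʳ-≤ q (levelExponent-bound {t} {p} {q} {4 * a} b₀ tp≤4aq) ⟩
  q * ((2 * (4 * a)) ^ b₀ * q ^ b₀)
    ≡⟨ cong (λ c → q * (c ^ b₀ * q ^ b₀)) (solve 1 (λ a → con 2 :* (con 4 :* a) := con 8 :* a) refl a) ⟩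
  q * ((8 * a) ^ b₀ * q ^ b₀)
    ≤⟨ *-monoʳ-≤ q (*-monoˡ-≤ (q ^ b₀) (^-monoˡ-≤ b₀ (m≤m*n (8 * a) b))) ⟩
  q * (C′ ^ b₀ * q ^ b₀)
    ≤⟨ *-monoʳ-≤ q (*-monoˡ-≤ (q ^ b₀) (m≤n*m (C′ ^ b₀) C′ {{C′≢0}})) ⟩
  q * (C′ ^ b * q ^ b₀)
    ≡⟨ solve 3 (λ q C qᵏ → q :* (C :* qᵏ) := q :* qᵏ :* C) refl q (C′ ^ b) (q ^ b₀) ⟩
  q ^ b * C′ ^ b ∎
  where
  open ≤-Reasoning
  b = suc b₀
  H = levelExponent t b₀
  C′ = 8 * a * b
  C′≢0 : NonZero C′
  C′≢0 = >-nonZero (≤-trans (s≤s z≤n) (*-mono-≤ (*-monoʳ-≤ 8 a≥1) (s≤s (z≤n {b₀}))))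

IndepBound-intro : ∀ {n m a₀ b₀ N} → 0 < m → m ≤ n → suc b₀ ! * N ≤ n ^ suc b₀ →
  (∀ T → m < n → m ^ T * n ^ suc (suc a₀) ≤ n ^ T →
     (suc b₀ ! * N) ^ levelExponent (suc T) b₀ * n ≤ m * n ^ (suc b₀ * levelExponent (suc T) b₀)) →
  IndepBound n m (suc a₀) (suc b₀) N
IndepBound-intro {n} {m} {a₀} {b₀} {N} m>0 m≤n X≤nᵇ levels = X≤nᵇ , bound
  where
  a = suc a₀
  b = suc b₀
  X = b ! * N
  C = (8 * a * b) ^ b
  n>0 = ≤-trans m>0 m≤n
  bound : ∀ p q → 1 ≤ q → m ^ q * n ^ p < n ^ q → X ^ (q ^ b * C) * n ^ (p ^ b) ≤ n ^ (b * (q ^ b * C))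
  bound zero      q _   _   = pad-exponent {X} {n} {b} {0} {q ^ b * C} {n ^ (0 ^ b)} X≤nᵇ z≤n
                                (≤-reflexive (cong (n ^_) (sym (*-zeroʳ b))))
  bound p@(suc _) q q>0 gap with ceiling-multiple (suc a * q) p
  ... | T , a′q≤pT , pT≤a′q+p =
    pad-exponent {X} {n} {b} {H * q * p ^ b₀} {q ^ b * C} {n ^ (p ^ b)} X≤nᵇ
                 (exponent-budget {a} {b₀} {p} {q} (s≤s z≤n) tp≤4aq) Xᴴᵠᵏnᵖᵏ≤nᵇᴴᵠᵏ
    where
    H = levelExponent (suc T) b₀
    tp≤4aq : suc T * p ≤ 4 * a * q
    tp≤4aq = step-count-bound {a} {p} {q} {T} (s≤s z≤n) (gap⇒p≤q {m} {n} {p} {q} m>0 n>0 gap) pT≤a′q+p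
    Xᴴn≤mnᵇᴴ : X ^ H * n ≤ m * n ^ (b * H)
    Xᴴn≤mnᵇᴴ = levels T (gap⇒m<n {m} {n} {p} {q} n>0 gap)
                        (mᵀnᴬ≤nᵀ {m} {n} {p} {q} {T} (suc a) q>0 (<⇒≤ gap) a′q≤pT n>0)
    Xᴴᵠᵏnᵖᵏ≤nᵇᴴᵠᵏ : X ^ (H * q * p ^ b₀) * n ^ (p * p ^ b₀) ≤ n ^ (b * (H * q * p ^ b₀))
    Xᴴᵠᵏnᵖᵏ≤nᵇᴴᵠᵏ = subst (λ e → X ^ (H * q * p ^ b₀) * n ^ (p * p ^ b₀) ≤ n ^ e)
      (solve 4 (λ b H q k → b :* H :* q :* k := b :* (H :* q :* k)) refl b H q (p ^ b₀))
      (raise-exponents {X} {n} {H * q} {p} {b * H * q} (p ^ b₀)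
        (cancel-gap {X} {n} {m} {b * H} {H} {p} {q} n>0 Xᴴn≤mnᵇᴴ (<⇒≤ gap)))

lemma2p2 : (a b n m : ℕ) → 1 ≤ a → 1 ≤ b → m ≤ n →
    (G : Graph n) → BKaFree G b a → EveryMSetHasKa G m a →
    IndepBound n m a b (numIndepSets G b)
lemma2p2 (suc a₀) (suc b₀) n m _ _ m≤n G bKa-free every =
  subst (IndepBound n m (suc a₀) (suc b₀)) (sym (numIndepSets≡#indep (suc b₀)))
    (IndepBound-intro {n} {m} {a₀} {b₀} (EveryMSetHasKa⇒m>0 every) m≤n (factorial-bound (suc b₀) ⊤)
      (λ T m<n mᵀnᵃ⁺¹≤nᵀ → levels every m<n mᵀnᵃ⁺¹≤nᵀ b₀ ⊤ (λ copies → bKa-free (proj₁ copies))))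
  where
  open IndependentSets G
  open Cliques G a₀
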